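{- (1) The map $C\mapsto\underline C=\{\underline u:u\in C\}$ is a bijection from the cover-components of $\Gamma$ to the quotient-components of $\underline\Gamma$. Suppose moreover that the grading is strong. Then: (2) for every $k$, the same map is a bijection from cover-up-components in dimension $k$ to quotient-up-components in dimension $k$, and likewise from cover-down-components to quotient-down-components; (3) if $\underline C_k$ is a quotient-down-component in dimension $k$ that is not a root, then $\underline C_{k-1}=\{\underline t:\underline t\subset\underline u\text{ for some }\underline u\in\underline C_k\}$ is a quotient-up-component in dimension $k-1$ that is not a leaf; this association and the inverse association $\underline C_k=\{\underline u:\underline u\supset\underline t\text{ for some }\underline t\in\underline C_{k-1}\}$ form a bijection between quotient-down-components in dimension $k$ that are not roots and quotient-up-components in dimension $k-1$ that are not leaves; similarly, cover-down-components in dimension $k$ that are not involutory pairs of roots are in bijection with cover-up-components in dimension $k-1$ that are not involutory pairs of leaves; (4) the bijection in (3) restricts to a bijection between coherent-down-components in dimension $k$ and coherent-up-components in dimension $k-1$.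
   Context: A double cover of a graded signed graph is $\Gamma=(X,E,[\cdot:\cdot],\dim,-)$: $X$ finite nonempty, $E$ directed edges ($u\subset v$), signature $[v:u]\in\{\pm1\}$ for each edge, $\dim:X\to\mathbb Z$, $-$ a fixed-point-free involution, with: $u\subset v\Rightarrow\dim u<\dim v$, $-u\subset v$, $u\subset-v$, $[-v:u]=[v:-u]=-[v:u]$; $\dim(-u)=\dim u$. Strong grading: $u\subset v\Rightarrow\dim v=\dim u+1$. Quotient $\underline\Gamma$: nodes $\underline u=\{u,-u\}$, edges $\underline u\subset\underline v$ iff $u\subset v$. Leaf: no $\underline v\supset\underline u$; root: no $\underline t\subset\underline u$; isolated: both; a node of $X$ is a leaf/root/isolated if its class is. An orientation is a map $\mathcal O$ with $\mathcal O(\underline u)\in\{u,-u\}$. A quotient-component is a connected component of the underlying undirected graph of $\underline\Gamma$ (isolated nodes included). A cover-component is either a connected component of the underlying undirected graph of $\Gamma$ on non-isolated nodes, or a pair $\{u,-u\}$ of isolated nodes. Distinct nodes of the same dimension $k$ are up-adjacent if some node of dimension $k+1$ lies above both, down-adjacent if some node of dimension $k-1$ lies below both (in $\underline\Gamma$ or in $\Gamma$). A quotient-up-(down-)component in dimension $k$ is a maximal subset of $\underline X_k$ connected under up-(down-)adjacency (so a single leaf, resp. root, is one). A cover-up-component in dimension $k$ is either a maximal up-connected subset of non-leaf nodes of $X_k$, or a pair $\{u,-u\}$ of leaves in $X_k$; a cover-down-component is defined dually with roots. A quotient-up-component $\underline C$ in dimension $k$ is coherent if it is not a leaf and some orientation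 satisfies $[v:u]=[v:u']$ for all $u,u'\in\mathcal O(\underline C)$ and $v\in X_{k+1}$ with $u,u'\subset v$; a quotient-down-component $\underline C$ is coherent if it is not a root and some orientation satisfies $[u:t]=[u':t]$ for all $u,u'\in\mathcal O(\underline C)$ and $t\in X_{k-1}$ with $t\subset u,u'$. -}

module Defs where

open import Level using (0ℓ)
open import Data.Nat using (ℕ; NonZero)
open import Data.Fin using (Fin)
open import Data.Bool using (Bool; T)
open import Data.Integer using (ℤ; _+_; _-_; 1ℤ; _<_)
open import Data.Sign using (Sign; opposite)
open import Data.Product using (Σ; ∃; _×_; _,_)
open import Data.Sum using (_⊎_)
open import Relation.Nullary using (¬_)
open import Relation.Unary using (Pred; _∈_; _≐_)
open import Relation.Binary.PropositionalEquality using (_≡_; _≢_)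
open import Relation.Binary.Construct.Closure.ReflexiveTransitive using (Star)
open import Function.Bundles using (_⇔_)

-- The finite edge set E is given by its
-- (decidable) indicator: u ⊂ v  iff  T (edge u v).
-- sig v u = [v:u]  (only meaningful when u ⊂ v).

record DoubleCover : Set where
  field
    n        : ℕ
    nonempty : NonZero n
    edge     : Fin n → Fin n → Bool
    sig      : Fin n → Fin n → Sign
    dim      : Fin n → ℤ
    neg      : Fin n → Fin n

  infix 4 _⊂_
  _⊂_ : Fin n → Fin n → Set
  u ⊂ v = T (edge u v)

  field
    neg-invol : ∀ u → neg (neg u) ≡ u
    neg-fpf   : ∀ u → neg u ≢ u
    dim-mono  : ∀ u v → u ⊂ v → dim u < dim v
    neg-subˡ  : ∀ u v → u ⊂ v → neg u ⊂ v
    neg-subʳ  : ∀ u v → u ⊂ v → u ⊂ neg v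
    sig-negᵗ  : ∀ u v → u ⊂ v → sig (neg v) u ≡ opposite (sig v u)
    sig-negᵇ  : ∀ u v → u ⊂ v → sig v (neg u) ≡ opposite (sig v u)
    dim-neg   : ∀ u → dim (neg u) ≡ dim u

BijectiveOn : ∀ {m} → (Pred (Pred (Fin m) 0ℓ) 0ℓ) → (Pred (Pred (Fin m) 0ℓ) 0ℓ)
            → (Pred (Fin m) 0ℓ → Pred (Fin m) 0ℓ) → Set₁
BijectiveOn P Q f =
  (∀ C → P C → Q (f C)) ×
  (∀ C C′ → P C → P C′ → f C ≐ f C′ → C ≐ C′) ×
  (∀ D → Q D → ∃ λ C → P C × (f C ≐ D))

InverseOn : ∀ {m} → (Pred (Pred (Fin m) 0ℓ) 0ℓ) → (Pred (Pred (Fin m) 0ℓ) 0ℓ)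
          → (Pred (Fin m) 0ℓ → Pred (Fin m) 0ℓ)
          → (Pred (Fin m) 0ℓ → Pred (Fin m) 0ℓ) → Set₁
InverseOn P Q f g =
  (∀ C → P C → Q (f C)) ×
  (∀ D → Q D → P (g D)) ×
  (∀ C → P C → g (f C) ≐ C) ×
  (∀ D → Q D → f (g D) ≐ D)

module _ (Γ : DoubleCover) where
  open DoubleCover Γ

  Node : Set
  Node = Fin n

  NodeSet : Set₁
  NodeSet = Pred Node 0ℓ

  StrongGrading : Set
  StrongGrading = ∀ u v → u ⊂ v → dim v ≡ dim u + 1ℤ

  -- Leaf / root / isolated (of the class u̲ = {u, -u}; u̲ ⊂ v̲ iff u ⊂ v).
  Leaf : Node → Set
  Leaf u = ∀ v → ¬ (u ⊂ v)

  Root : Node → Set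
  Root u = ∀ t → ¬ (t ⊂ u)

  Isolated : Node → Set
  Isolated u = Leaf u × Root u

  PairOf : Node → NodeSet
  PairOf u v = v ≡ u ⊎ v ≡ neg u

  IsLeafPair : NodeSet → Set
  IsLeafPair S = ∃ λ u → Leaf u × (∀ v → (v ∈ S ⇔ PairOf u v))

  IsRootPair : NodeSet → Set
  IsRootPair S = ∃ λ u → Root u × (∀ v → (v ∈ S ⇔ PairOf u v))

  -- Sets of quotient nodes are encoded as negation-closed subsets of X
  -- (a set of classes ↦ the union of its classes).
  -- The map C ↦ C̲ = {u̲ : u ∈ C}:
  Sat : NodeSet → NodeSet
  Sat C v = v ∈ C ⊎ neg v ∈ C

  Below : NodeSet → NodeSet
  Below D t = ∃ λ u → u ∈ D × t ⊂ u

  Above : NodeSet → NodeSet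
  Above U u = ∃ λ t → t ∈ U × t ⊂ u

  Adj : Node → Node → Set
  Adj u v = u ⊂ v ⊎ v ⊂ u

  -- adjacency in the quotient, lifted to representatives, plus switching
  -- representative within a class
  QStep : Node → Node → Set
  QStep u v = Adj u v ⊎ v ≡ neg u

  IsCoverComponent : NodeSet → Set
  IsCoverComponent S =
    (∃ λ u → ¬ Isolated u × (∀ v → (v ∈ S ⇔ Star Adj u v))) ⊎
    (∃ λ u → Isolated u × (∀ v → (v ∈ S ⇔ PairOf u v)))

  IsQuotientComponent : NodeSet → Set
  IsQuotientComponent S = ∃ λ u → ∀ v → (v ∈ S ⇔ Star QStep u v)

  CUp : ℤ → Node → Node → Set
  CUp k a b = dim a ≡ k × dim b ≡ k × (∃ λ w → dim w ≡ k + 1ℤ × a ⊂ w × b ⊂ w)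

  CDown : ℤ → Node → Node → Set
  CDown k a b = dim a ≡ k × dim b ≡ k × (∃ λ t → dim t ≡ k - 1ℤ × t ⊂ a × t ⊂ b)

  QUp : ℤ → Node → Node → Set
  QUp k a b = CUp k a b ⊎ b ≡ neg a

  QDown : ℤ → Node → Node → Set
  QDown k a b = CDown k a b ⊎ b ≡ neg a

  IsQuotientUpComponent : ℤ → NodeSet → Set
  IsQuotientUpComponent k S =
    ∃ λ u → dim u ≡ k × (∀ v → (v ∈ S ⇔ Star (QUp k) u v))

  IsQuotientDownComponent : ℤ → NodeSet → Set
  IsQuotientDownComponent k S =
    ∃ λ u → dim u ≡ k × (∀ v → (v ∈ S ⇔ Star (QDown k) u v))

  IsCoverUpComponent : ℤ → NodeSet → Set
  IsCoverUpComponent k S =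
    (∃ λ u → dim u ≡ k × ¬ Leaf u × (∀ v → (v ∈ S ⇔ Star (CUp k) u v))) ⊎
    (∃ λ u → dim u ≡ k × Leaf u × (∀ v → (v ∈ S ⇔ PairOf u v)))

  IsCoverDownComponent : ℤ → NodeSet → Set
  IsCoverDownComponent k S =
    (∃ λ u → dim u ≡ k × ¬ Root u × (∀ v → (v ∈ S ⇔ Star (CDown k) u v))) ⊎
    (∃ λ u → dim u ≡ k × Root u × (∀ v → (v ∈ S ⇔ PairOf u v)))

  IsOrientation : (Node → Node) → Set
  IsOrientation O = ∀ u → O (neg u) ≡ O u × PairOf u (O u)

  IsCoherentUp : ℤ → NodeSet → Set
  IsCoherentUp k S =
    IsQuotientUpComponent k S × ¬ IsLeafPair S ×
    (∃ λ O → IsOrientation O ×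
      (∀ a b v → a ∈ S → b ∈ S → dim v ≡ k + 1ℤ →
         O a ⊂ v → O b ⊂ v → sig v (O a) ≡ sig v (O b)))

  IsCoherentDown : ℤ → NodeSet → Set
  IsCoherentDown k S =
    IsQuotientDownComponent k S × ¬ IsRootPair S ×
    (∃ λ O → IsOrientation O ×
      (∀ a b t → a ∈ S → b ∈ S → dim t ≡ k - 1ℤ →
         t ⊂ O a → t ⊂ O b → sig (O a) t ≡ sig (O b) t))

{-# OPTIONS --safe #-}
module Submission where

open import Defs
open import Data.Integer using (ℤ; _-_; 1ℤ)
open import Data.Product using (_×_)
open import Relation.Nullary using (¬_)

open import Level using (0ℓ)
open import Function using (_∘_; flip; id)
open import Function.Bundles using (_⇔_; mk⇔; Equivalence)
import Function.Properties.Equivalence as ⇔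
open import Data.Empty using (⊥-elim)
open import Data.Unit using (⊤; tt)
open import Data.Sum as Sum using (_⊎_; inj₁; inj₂)
open import Data.Product as Product using (∃; _,_; proj₁; proj₂)
open import Data.Fin using (Fin)
open import Data.Fin.Properties using (any?)
open import Data.Sign as Sign using (Sign; opposite)
open import Data.Sign.Properties using (opposite-injective)
open import Data.Integer using (_+_)
open import Data.Integer.Properties using (+-0-abelianGroup)
open import Algebra.Properties.AbelianGroup +-0-abelianGroup using (//-rightDividesˡ; //-rightDividesʳ)
open import Relation.Nullary using (Dec; yes; no)
open import Relation.Nullary.Decidable using (T?)
open import Relation.Unary using (Pred; _∈_; _⊆_; _≐_)
open import Relation.Unary.Properties using (≐-sym; ≐-trans)
open import Relation.Binary.Core using (Rel)
open import Relation.Binary.PropositionalEquality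
  using (_≡_; _≢_; refl; sym; trans; cong; subst; module ≡-Reasoning)
open import Relation.Binary.Construct.Closure.ReflexiveTransitive
  using (Star; ε; _◅_; _◅◅_; fold; return)
  renaming (map to Star-map)

open Equivalence using (to; from)

-- Since −u ⊂ v whenever u ⊂ v, a node u that is not isolated (resp. not a leaf, not a root) is
-- joined to −u inside its own cover-component. So adjoining the quotient moves u ↦ −u enlarges
-- no cover-component except those of isolated nodes (leaves, roots), whose class is {u, −u}:
-- as negation-closed subsets of X, cover-components and quotient-components are the same sets,
-- and C ↦ C̲ is the identity on them.
--
-- With a strong grading, if u in a down-component D of dimension k has a face t, the faces of D
-- form the up-component of t: a down-adjacency in D through a face becomes an up-adjacency of
-- faces through a node of D, and conversely. The same argument for the dual incidence recovers
-- D as the cofaces of its faces.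
--
-- A coherent orientation O of D induces one on its faces: orient each face y so that
-- [O u : y] = +1 for some u ∈ D above y. Coherence of O makes this hold for every such u,
-- so [w : y] = ±1 with a sign depending only on w.

module _ {a t} {A : Set a} {T : Rel A t} where

  Star-preserves : ∀ {p} (P : Pred A p) → (∀ {x y} → T x y → P x → P y) →
                   ∀ {x y} → Star T x y → P x → P y
  Star-preserves P step = fold (λ x y → P x → P y) (λ r k → k ∘ step r) id

  Star-first-step : ∀ {x y} → x ≢ y → Star T x y → ∃ (T x)
  Star-first-step x≢y ε       = ⊥-elim (x≢y refl)
  Star-first-step _   (r ◅ _) = _ , r

  module _ {d} {D : Pred A d} {u : A} (D⇔ : ∀ v → v ∈ D ⇔ Star T u v) where

    reach-closed : ∀ {x y} → T x y → x ∈ D → y ∈ D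
    reach-closed r x∈D = from (D⇔ _) (to (D⇔ _) x∈D ◅◅ return r)

    reach-induction : ∀ {p} {P : Pred A p} → P u → (∀ {x y} → T x y → P x → P y) → D ⊆ P
    reach-induction {P = P} Pu step x∈D = Star-preserves P step (to (D⇔ _) x∈D) Pu

module _ {a ℓ₁ ℓ₂} {A : Set a} {S : Pred A ℓ₁} {R : Pred A ℓ₂} where

  pointwise⇒≐ : (∀ v → v ∈ S ⇔ R v) → S ≐ R
  pointwise⇒≐ S⇔R = (λ {v} → to (S⇔R v)) , (λ {v} → from (S⇔R v))

  ≐⇒pointwise : S ≐ R → ∀ v → v ∈ S ⇔ R v
  ≐⇒pointwise (S⊆R , R⊆S) v = mk⇔ S⊆R R⊆S

module _ {m} {P Q : Pred (Pred (Fin m) 0ℓ) 0ℓ} where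

  BijectiveOn-⇔ : ∀ {P′ Q′ f} → (∀ C → P C ⇔ P′ C) → (∀ D → Q D ⇔ Q′ D) →
                  BijectiveOn P Q f → BijectiveOn P′ Q′ f
  BijectiveOn-⇔ P⇔ Q⇔ (maps , injective , surjective) =
    (λ C p → to (Q⇔ _) (maps C (from (P⇔ C) p))) ,
    (λ C C′ p p′ → injective C C′ (from (P⇔ C) p) (from (P⇔ C′) p′)) ,
    (λ D q → Product.map₂ (Product.map₁ (to (P⇔ _))) (surjective D (from (Q⇔ D) q)))

  module _ {f g : Pred (Fin m) 0ℓ → Pred (Fin m) 0ℓ} where

    InverseOn-intro : (∀ C → P C → Q (f C) × g (f C) ≐ C) →
                      (∀ D → Q D → P (g D) × f (g D) ≐ D) →
                      InverseOn P Q f g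
    InverseOn-intro there back =
      (λ C p → proj₁ (there C p)) , (λ D q → proj₁ (back D q)) ,
      (λ C p → proj₂ (there C p)) , (λ D q → proj₂ (back D q))

    InverseOn-restrict : ∀ {P′ Q′} → InverseOn P Q f g → P′ ⊆ P → Q′ ⊆ Q →
                         (∀ C → P′ C → Q′ (f C)) → (∀ D → Q′ D → P′ (g D)) →
                         InverseOn P′ Q′ f g
    InverseOn-restrict (_ , _ , gf , fg) P′⊆P Q′⊆Q there back =
      there , back , (λ C p → gf C (P′⊆P p)) , (λ D q → fg D (Q′⊆Q q))

module _ (Γ : DoubleCover) where
  open DoubleCover Γ

  private variable
    t u v w x y : Node Γ
    S S′ D : NodeSet Γ

  PairOf-sym : PairOf Γ u v → PairOf Γ v u
  PairOf-sym (inj₁ refl) = inj₁ refl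
  PairOf-sym {u} (inj₂ refl) = inj₂ (sym (neg-invol u))

  PairOf-neg : PairOf Γ u v → PairOf Γ u (neg v)
  PairOf-neg (inj₁ refl) = inj₂ refl
  PairOf-neg {u} (inj₂ refl) = inj₁ (neg-invol u)

  PairOf-trans : PairOf Γ u v → PairOf Γ v w → PairOf Γ u w
  PairOf-trans (inj₁ refl) q = q
  PairOf-trans (inj₂ refl) (inj₁ refl) = inj₂ refl
  PairOf-trans {u} (inj₂ refl) (inj₂ refl) = inj₁ (neg-invol u)

  pair-closed : ∀ {p} {P : Pred (Node Γ) p} → (∀ {x} → P x → P (neg x)) →
                P u → PairOf Γ u v → P v
  pair-closed _     Pu (inj₁ refl) = Pu
  pair-closed P-neg Pu (inj₂ refl) = P-neg Pu

  Sat-bijectiveOn : {P Q : Pred (NodeSet Γ) 0ℓ} → (∀ C → P C ⇔ Q C) →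
                    (∀ D → Q D → Sat Γ D ⊆ D) → (∀ {D D′} → D ≐ D′ → Q D → Q D′) →
                    BijectiveOn P Q (Sat Γ)
  Sat-bijectiveOn {Q = Q} P⇔Q closed resp =
    (λ C p → resp (≐-sym (Sat≐ (to (P⇔Q C) p))) (to (P⇔Q C) p)) ,
    (λ C C′ p p′ (C⊆C′ , C′⊆C) →
       (λ x∈C → closed C′ (to (P⇔Q C′) p′) (C⊆C′ (inj₁ x∈C))) ,
       (λ x∈C′ → closed C (to (P⇔Q C) p) (C′⊆C (inj₁ x∈C′)))) ,
    (λ D q → D , from (P⇔Q D) q , Sat≐ q)
    where
    Sat≐ : ∀ {D} → Q D → Sat Γ D ≐ D
    Sat≐ q = closed _ q , inj₁

  WithNeg : Rel (Node Γ) 0ℓ → Rel (Node Γ) 0ℓ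
  WithNeg A x y = A x y ⊎ y ≡ neg x

  module Components
    (A : Rel (Node Γ) 0ℓ) (Base Linked Stranded : Pred (Node Γ) 0ℓ)
    (linked-or-stranded : ∀ {u} → Base u → Linked u ⊎ Stranded u)
    (linked-step : ∀ {x y} → A x y → Linked y)
    (linked-neg : ∀ {x} → Linked x → Star A x (neg x))
    (stranded-¬step : ∀ {x y} → Stranded x → ¬ A x y)
    (stranded-neg : ∀ {x} → Stranded x → Stranded (neg x))
    where

    IsCoverComp : NodeSet Γ → Set
    IsCoverComp S =
      (∃ λ u → Base u × ¬ Stranded u × (∀ v → v ∈ S ⇔ Star A u v)) ⊎
      (∃ λ u → Base u × Stranded u × (∀ v → v ∈ S ⇔ PairOf Γ u v))

    IsQuotComp : NodeSet Γ → Set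
    IsQuotComp S = ∃ λ u → Base u × (∀ v → v ∈ S ⇔ Star (WithNeg A) u v)

    linked⇒¬stranded : Linked u → ¬ Stranded u
    linked⇒¬stranded {u} l s =
      stranded-¬step s (proj₂ (Star-first-step (neg-fpf u ∘ sym) (linked-neg l)))

    linked-reach : Linked u → Star A u v → Linked v
    linked-reach l p = Star-preserves Linked (λ r _ → linked-step r) p l

    Star⇔Star-WithNeg : Linked u → ∀ v → Star A u v ⇔ Star (WithNeg A) u v
    Star⇔Star-WithNeg {u} l v = mk⇔ (Star-map inj₁) (λ p → Star-preserves (Star A u) step p ε)
      where
      step : WithNeg A x y → Star A u x → Star A u y
      step (inj₁ r)    p = p ◅◅ return r
      step (inj₂ refl) p = p ◅◅ linked-neg (linked-reach l p)

    PairOf⇔Star-WithNeg : Stranded u → ∀ v → PairOf Γ u v ⇔ Star (WithNeg A) u v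
    PairOf⇔Star-WithNeg {u} s v = mk⇔ pair⇒star (λ p → Star-preserves (PairOf Γ u) step p (inj₁ refl))
      where
      pair⇒star : PairOf Γ u v → Star (WithNeg A) u v
      pair⇒star (inj₁ refl) = ε
      pair⇒star (inj₂ refl) = return (inj₂ refl)
      step : WithNeg A x y → PairOf Γ u x → PairOf Γ u y
      step (inj₁ r)    p = ⊥-elim (stranded-¬step (pair-closed stranded-neg s p) r)
      step (inj₂ refl) p = PairOf-neg p

    cover⇔quotient : ∀ S → IsCoverComp S ⇔ IsQuotComp S
    cover⇔quotient S = mk⇔ cover⇒quotient quotient⇒cover
      where
      cover⇒quotient : IsCoverComp S → IsQuotComp S
      cover⇒quotient (inj₁ (u , base , ¬s , S⇔)) with linked-or-stranded base
      ... | inj₁ l = u , base , λ v → ⇔.trans (S⇔ v) (Star⇔Star-WithNeg l v)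
      ... | inj₂ s = ⊥-elim (¬s s)
      cover⇒quotient (inj₂ (u , base , s , S⇔)) =
        u , base , λ v → ⇔.trans (S⇔ v) (PairOf⇔Star-WithNeg s v)
      quotient⇒cover : IsQuotComp S → IsCoverComp S
      quotient⇒cover (u , base , S⇔) with linked-or-stranded base
      ... | inj₁ l = inj₁ (u , base , linked⇒¬stranded l ,
                           λ v → ⇔.trans (S⇔ v) (⇔.sym (Star⇔Star-WithNeg l v)))
      ... | inj₂ s = inj₂ (u , base , s , λ v → ⇔.trans (S⇔ v) (⇔.sym (PairOf⇔Star-WithNeg s v)))

    quotient-Sat-closed : ∀ S → IsQuotComp S → Sat Γ S ⊆ S
    quotient-Sat-closed S _            (inj₁ v∈S)  = v∈S
    quotient-Sat-closed S (_ , _ , S⇔) {v} (inj₂ -v∈S) =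
      reach-closed S⇔ (inj₂ (sym (neg-invol v))) -v∈S

    quotient-resp : S ≐ S′ → IsQuotComp S → IsQuotComp S′
    quotient-resp S≐S′ (u , base , S⇔) = u , base , λ v → ⇔.trans (≐⇒pointwise (≐-sym S≐S′) v) (S⇔ v)

    Sat-bijective : BijectiveOn IsCoverComp IsQuotComp (Sat Γ)
    Sat-bijective = Sat-bijectiveOn cover⇔quotient quotient-Sat-closed quotient-resp

  -- Down- and up-notions are treated uniformly: for `faces`, x ⟶ t means t ⊂ x and
  -- σ x t = [x : t]; for its dual `cofaces`, x ⟶ w means x ⊂ w and σ x w = [w : x].
  record Incidence : Set₁ where
    field
      _⟶_    : Rel (Node Γ) 0ℓ
      _⟶?_   : ∀ x y → Dec (x ⟶ y)
      ⟶-negˡ : x ⟶ y → neg x ⟶ y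
      ⟶-negʳ : x ⟶ y → x ⟶ neg y
      σ      : Node Γ → Node Γ → Sign
      σ-negˡ : x ⟶ y → σ (neg x) y ≡ opposite (σ x y)
      σ-negʳ : x ⟶ y → σ x (neg y) ≡ opposite (σ x y)

  dual : Incidence → Incidence
  dual I = record
    { _⟶_ = flip _⟶_ ; _⟶?_ = flip _⟶?_ ; ⟶-negˡ = ⟶-negʳ ; ⟶-negʳ = ⟶-negˡ
    ; σ = flip σ ; σ-negˡ = σ-negʳ ; σ-negʳ = σ-negˡ }
    where open Incidence I

  faces : Incidence
  faces = record
    { _⟶_ = λ x t → t ⊂ x ; _⟶?_ = λ x t → T? (edge t x)
    ; ⟶-negˡ = λ {x} {t} → neg-subʳ t x ; ⟶-negʳ = λ {x} {t} → neg-subˡ t x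
    ; σ = sig ; σ-negˡ = λ {x} {t} → sig-negᵗ t x ; σ-negʳ = λ {x} {t} → sig-negᵇ t x }

  cofaces : Incidence
  cofaces = dual faces

  orientBy : Sign → Node Γ → Node Γ
  orientBy Sign.+ x = x
  orientBy Sign.- x = neg x

  orientBy-pair : ∀ s x → PairOf Γ x (orientBy s x)
  orientBy-pair Sign.+ x = inj₁ refl
  orientBy-pair Sign.- x = inj₂ refl

  -- For `faces` and k′ = k - 1, Stuck, StuckPair, Img, Adjacent k k′, IsCoverComp k k′,
  -- IsQuotComp k k′ and IsCoherentComp k k′ unfold to Root, IsRootPair, Below, CDown k,
  -- IsCoverDownComponent k, IsQuotientDownComponent k and IsCoherentDown k; for `cofaces` and
  -- k′ = k + 1, to the corresponding up-notions.
  module Along (I : Incidence) where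
    open Incidence I

    Stuck : Pred (Node Γ) 0ℓ
    Stuck u = ∀ v → ¬ u ⟶ v

    StuckPair : NodeSet Γ → Set
    StuckPair S = ∃ λ u → Stuck u × (∀ v → v ∈ S ⇔ PairOf Γ u v)

    Img : NodeSet Γ → NodeSet Γ
    Img S x = ∃ λ y → y ∈ S × y ⟶ x

    Adjacent : ℤ → ℤ → Rel (Node Γ) 0ℓ
    Adjacent k k′ x y = dim x ≡ k × dim y ≡ k × (∃ λ w → dim w ≡ k′ × x ⟶ w × y ⟶ w)

    IsCoverComp : ℤ → ℤ → NodeSet Γ → Set
    IsCoverComp k k′ S =
      (∃ λ u → dim u ≡ k × ¬ Stuck u × (∀ v → v ∈ S ⇔ Star (Adjacent k k′) u v)) ⊎
      (∃ λ u → dim u ≡ k × Stuck u × (∀ v → v ∈ S ⇔ PairOf Γ u v))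

    IsQuotComp : ℤ → ℤ → NodeSet Γ → Set
    IsQuotComp k k′ S = ∃ λ u → dim u ≡ k × (∀ v → v ∈ S ⇔ Star (WithNeg (Adjacent k k′)) u v)

    Coherent : ℤ → NodeSet Γ → (Node Γ → Node Γ) → Set
    Coherent k′ S O = ∀ x y w → x ∈ S → y ∈ S → dim w ≡ k′ →
                      O x ⟶ w → O y ⟶ w → σ (O x) w ≡ σ (O y) w

    IsCoherentComp : ℤ → ℤ → NodeSet Γ → Set
    IsCoherentComp k k′ S = IsQuotComp k k′ S × ¬ StuckPair S × (∃ λ O → IsOrientation Γ O × Coherent k′ S O)

    neighbour-or-stuck : ∀ u → ∃ (u ⟶_) ⊎ Stuck u
    neighbour-or-stuck u with any? (u ⟶?_)
    ... | yes n = inj₁ n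
    ... | no ∄n = inj₂ (λ v u⟶v → ∄n (v , u⟶v))

    Stuck-neg : Stuck u → Stuck (neg u)
    Stuck-neg {u} stuck v -u⟶v = stuck v (subst (_⟶ v) (neg-invol u) (⟶-negˡ -u⟶v))

    reach-¬StuckPair : ∀ {R : Rel (Node Γ) 0ℓ} → ¬ Stuck u →
                       (∀ v → v ∈ S ⇔ Star R u v) → ¬ StuckPair S
    reach-¬StuckPair ¬stuck S⇔ (w , stuck , S⇔pair) =
      ¬stuck (pair-closed Stuck-neg stuck (to (S⇔pair _) (from (S⇔ _) ε)))

    ⟶-pairˡ : PairOf Γ u v → u ⟶ w → v ⟶ w
    ⟶-pairˡ (inj₁ refl) u⟶w = u⟶w
    ⟶-pairˡ (inj₂ refl) u⟶w = ⟶-negˡ u⟶w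

    ⟶-pairʳ : PairOf Γ u v → w ⟶ u → w ⟶ v
    ⟶-pairʳ (inj₁ refl) w⟶u = w⟶u
    ⟶-pairʳ (inj₂ refl) w⟶u = ⟶-negʳ w⟶u

    Img-resp : S ≐ S′ → Img S ≐ Img S′
    Img-resp (S⊆S′ , S′⊆S) =
      (λ (y , y∈S , y⟶x) → y , S⊆S′ y∈S , y⟶x) , (λ (y , y∈S′ , y⟶x) → y , S′⊆S y∈S′ , y⟶x)

    Img-pair : x ∈ Img S → PairOf Γ x y → y ∈ Img S
    Img-pair (u , u∈S , u⟶x) p = u , u∈S , ⟶-pairʳ p u⟶x

    reach-dim : ∀ {k k′} → dim u ≡ k → Star (Adjacent k k′) u v → dim v ≡ k
    reach-dim du p = Star-preserves (λ x → dim x ≡ _) (λ (_ , dy , _) _ → dy) p du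

    σ-orientBy-self : x ⟶ y → σ x (orientBy (σ x y) y) ≡ Sign.+
    σ-orientBy-self {x} {y} x⟶y with σ x y in eq
    ... | Sign.+ = eq
    ... | Sign.- = trans (σ-negʳ x⟶y) (cong opposite eq)

    σ-pair-agree : PairOf Γ w u → σ u x ≡ σ u y → w ⟶ x → w ⟶ y → σ w x ≡ σ w y
    σ-pair-agree (inj₁ refl) eq _ _ = eq
    σ-pair-agree {w} {x = x} {y} (inj₂ refl) eq w⟶x w⟶y = opposite-injective (begin
      opposite (σ w x) ≡⟨ σ-negˡ w⟶x ⟨
      σ (neg w) x      ≡⟨ eq ⟩
      σ (neg w) y      ≡⟨ σ-negˡ w⟶y ⟩
      opposite (σ w y) ∎)
      where open ≡-Reasoning

    -- The representative of y on which σ (O u) is positive, for the first u ⟶ y found;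
    -- for a coherent O the choice of u does not matter (see `orient-positive`).
    orient : (Node Γ → Node Γ) → Node Γ → Node Γ
    orient O y with any? (_⟶? y)
    ... | yes (u , _) = orientBy (σ (O u) y) y
    ... | no _        = y

    orient-pair : ∀ O y → PairOf Γ y (orient O y)
    orient-pair O y with any? (_⟶? y)
    ... | yes (u , _) = orientBy-pair (σ (O u) y) y
    ... | no _        = inj₁ refl

    orient-orientation : ∀ {O} → IsOrientation Γ O → IsOrientation Γ (orient O ∘ O)
    orient-orientation {O} isO t =
      cong (orient O) (proj₁ (isO t)) , PairOf-trans (proj₂ (isO t)) (orient-pair O (O t))

  adjacent-or-isolated : ∀ u → ∃ (Adj Γ u) ⊎ Isolated Γ u
  adjacent-or-isolated u
    with Along.neighbour-or-stuck cofaces u | Along.neighbour-or-stuck faces u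
  ... | inj₁ (w , u⊂w) | _              = inj₁ (w , inj₁ u⊂w)
  ... | inj₂ _         | inj₁ (t , t⊂u) = inj₁ (t , inj₂ t⊂u)
  ... | inj₂ leaf      | inj₂ root      = inj₂ (leaf , root)

  components-bijective : BijectiveOn (IsCoverComponent Γ) (IsQuotientComponent Γ) (Sat Γ)
  components-bijective = BijectiveOn-⇔ cover⇔ quotient⇔ C.Sat-bijective
    where
    adjacent-step : Adj Γ x y → ∃ (Adj Γ y)
    adjacent-step {x} (inj₁ x⊂y) = x , inj₂ x⊂y
    adjacent-step {x} (inj₂ y⊂x) = x , inj₁ y⊂x

    adjacent-neg : ∃ (Adj Γ x) → Star (Adj Γ) x (neg x)
    adjacent-neg {x} (w , inj₁ x⊂w) = inj₁ x⊂w ◅ inj₂ (neg-subˡ x w x⊂w) ◅ ε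
    adjacent-neg {x} (w , inj₂ w⊂x) = inj₂ w⊂x ◅ inj₁ (neg-subʳ w x w⊂x) ◅ ε

    isolated-¬adjacent : Isolated Γ x → ¬ Adj Γ x y
    isolated-¬adjacent {y = y} (leaf , _)    (inj₁ x⊂y) = leaf y x⊂y
    isolated-¬adjacent {y = y} (_    , root) (inj₂ y⊂x) = root y y⊂x

    isolated-neg : Isolated Γ x → Isolated Γ (neg x)
    isolated-neg (leaf , root) = Along.Stuck-neg cofaces leaf , Along.Stuck-neg faces root

    module C = Components (Adj Γ) (λ _ → ⊤) (λ x → ∃ (Adj Γ x)) (Isolated Γ)
                 (λ {u} _ → adjacent-or-isolated u) adjacent-step adjacent-neg isolated-¬adjacent isolated-neg

    cover⇔ : ∀ S → C.IsCoverComp S ⇔ IsCoverComponent Γ S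
    cover⇔ S = mk⇔ (Sum.map (Product.map₂ proj₂) (Product.map₂ proj₂))
                   (Sum.map (Product.map₂ (tt ,_)) (Product.map₂ (tt ,_)))

    quotient⇔ : ∀ S → C.IsQuotComp S ⇔ IsQuotientComponent Γ S
    quotient⇔ S = mk⇔ (Product.map₂ proj₂) (Product.map₂ (tt ,_))

  module Graded (I : Incidence) {k k′ : ℤ}
    (⟶-dim : ∀ {x w} → Incidence._⟶_ I x w → dim x ≡ k → dim w ≡ k′) where
    open Incidence I
    open Along I

    private
      module Dual = Along (dual I)

      Linked : Pred (Node Γ) 0ℓ
      Linked x = dim x ≡ k × ∃ (x ⟶_)

      linked-or-stuck : dim u ≡ k → Linked u ⊎ Stuck u
      linked-or-stuck {u} du = Sum.map₁ (du ,_) (neighbour-or-stuck u)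

      linked-step : Adjacent k k′ x y → Linked y
      linked-step (_ , dy , w , _ , _ , y⟶w) = dy , w , y⟶w

      linked-neg : Linked x → Star (Adjacent k k′) x (neg x)
      linked-neg {x} (dx , w , x⟶w) =
        return (dx , trans (dim-neg x) dx , w , ⟶-dim x⟶w dx , x⟶w , ⟶-negˡ x⟶w)

      stuck-¬adjacent : Stuck x → ¬ Adjacent k k′ x y
      stuck-¬adjacent stuck (_ , _ , w , _ , x⟶w , _) = stuck w x⟶w

      module C = Components (Adjacent k k′) (λ u → dim u ≡ k) Linked Stuck
                   linked-or-stuck linked-step linked-neg stuck-¬adjacent Stuck-neg

    cover⇔quotient : ∀ S → IsCoverComp k k′ S ⇔ IsQuotComp k k′ S
    cover⇔quotient = C.cover⇔quotient

    Sat-bijective : BijectiveOn (IsCoverComp k k′) (IsQuotComp k k′) (Sat Γ)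
    Sat-bijective = C.Sat-bijective

    Img-reach : dim u ≡ k → u ⟶ t → Img (Star (Adjacent k k′) u) ≐ Star (Dual.Adjacent k′ k) t
    Img-reach {u} {t} du u⟶t =
      (λ (y , u↝y , y⟶x) → Star-preserves Reaches step u↝y base _ y⟶x) ,
      (λ t↝x → Star-preserves (Img (Star (Adjacent k k′) u)) step′ t↝x (u , ε , u⟶t))
      where
      Reaches : Pred (Node Γ) 0ℓ
      Reaches y = ∀ x → y ⟶ x → Star (Dual.Adjacent k′ k) t x
      base : Reaches u
      base x u⟶x = return (⟶-dim u⟶t du , ⟶-dim u⟶x du , u , du , u⟶t , u⟶x)
      step : Adjacent k k′ x y → Reaches x → Reaches y
      step {y = y} (_ , dy , w , dw , x⟶w , y⟶w) reaches z y⟶z =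
        reaches w x⟶w ◅◅ return (dw , ⟶-dim y⟶z dy , y , dy , y⟶w , y⟶z)
      step′ : Dual.Adjacent k′ k x y → x ∈ Img (Star (Adjacent k k′) u) → y ∈ Img (Star (Adjacent k k′) u)
      step′ {x} (dx , _ , w , dw , w⟶x , w⟶y) (v , u↝v , v⟶x) =
        w , u↝v ◅◅ return (reach-dim du u↝v , dw , x , dx , v⟶x , w⟶x) , w⟶y

  module Transfer (I : Incidence) {k k′ : ℤ}
    (⟶-dim  : ∀ {x w} → Incidence._⟶_ I x w → dim x ≡ k → dim w ≡ k′)
    (⟶-dim⁻ : ∀ {w x} → Incidence._⟶_ I x w → dim w ≡ k′ → dim x ≡ k) where
    open Incidence I
    open Along I
    private
      module Dual = Along (dual I)
      module G  = Graded I ⟶-dim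
      module G′ = Graded (dual I) ⟶-dim⁻

    cover-transfer : IsCoverComp k k′ D × ¬ StuckPair D →
                     (Dual.IsCoverComp k′ k (Img D) × ¬ Dual.StuckPair (Img D)) × Dual.Img (Img D) ≐ D
    cover-transfer (inj₂ (u , _ , stuck , D⇔) , ¬sp) = ⊥-elim (¬sp (u , stuck , D⇔))
    cover-transfer {D} (inj₁ (u , du , ¬stuck , D⇔) , _) with neighbour-or-stuck u
    ... | inj₂ stuck    = ⊥-elim (¬stuck stuck)
    ... | inj₁ (t , u⟶t) =
      (inj₁ (t , dt , ¬stuck′ , ≐⇒pointwise ImgD≐) , Dual.reach-¬StuckPair ¬stuck′ (≐⇒pointwise ImgD≐)) ,
      ≐-trans (Dual.Img-resp ImgD≐) (≐-trans (G′.Img-reach dt u⟶t) (≐-sym (pointwise⇒≐ D⇔)))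
      where
      dt : dim t ≡ k′
      dt = ⟶-dim u⟶t du
      ¬stuck′ : ¬ Dual.Stuck t
      ¬stuck′ stuck = stuck u u⟶t
      ImgD≐ : Img D ≐ Star (Dual.Adjacent k′ k) t
      ImgD≐ = ≐-trans (Img-resp (pointwise⇒≐ D⇔)) (G.Img-reach du u⟶t)

    quotient-transfer : IsQuotComp k k′ D × ¬ StuckPair D →
                        (Dual.IsQuotComp k′ k (Img D) × ¬ Dual.StuckPair (Img D)) × Dual.Img (Img D) ≐ D
    quotient-transfer (q , ¬sp) =
      Product.map₁ (Product.map₁ (to (G′.cover⇔quotient _)))
        (cover-transfer (from (G.cover⇔quotient _) q , ¬sp))

    module _ {O : Node Γ → Node Γ} (q : IsQuotComp k k′ D)
             (isO : IsOrientation Γ O) (coh : Coherent k′ D O) where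

      private
        IsQuotComp-dim : D ⊆ (λ x → dim x ≡ k)
        IsQuotComp-dim = reach-induction (proj₂ (proj₂ q)) (proj₁ (proj₂ q)) step
          where
          step : WithNeg (Adjacent k k′) x y → dim x ≡ k → dim y ≡ k
          step (inj₁ (_ , dy , _)) _  = dy
          step {x} (inj₂ refl)     dx = trans (dim-neg x) dx

        common-neighbour : x ∈ D → x ⟶ y → w ⟶ y → w ∈ D
        common-neighbour {y = y} {w} x∈D x⟶y w⟶y =
          reach-closed (proj₂ (proj₂ q))
            (inj₁ (dx , ⟶-dim⁻ w⟶y (⟶-dim x⟶y dx) , y , ⟶-dim x⟶y dx , x⟶y , w⟶y)) x∈D
          where dx = IsQuotComp-dim x∈D

      orient-positive : y ∈ Img D → w ⟶ orient O y → σ (O w) (orient O y) ≡ Sign.+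
      orient-positive {y} {w} (v , v∈D , v⟶y) w⟶Oy with any? (_⟶? y)
      ... | no ∄u        = ⊥-elim (∄u (w , w⟶Oy))
      ... | yes (u , u⟶y) = begin
        σ (O w) (orientBy (σ (O u) y) y) ≡⟨ cong (λ s → σ (O w) (orientBy s y)) agree ⟩
        σ (O w) (orientBy (σ (O w) y) y) ≡⟨ σ-orientBy-self (⟶-pairˡ (proj₂ (isO w)) w⟶y) ⟩
        Sign.+                           ∎
        where
        open ≡-Reasoning
        w⟶y : w ⟶ y
        w⟶y = ⟶-pairʳ (PairOf-sym (orientBy-pair (σ (O u) y) y)) w⟶Oy
        agree : σ (O u) y ≡ σ (O w) y
        agree = coh u w y (common-neighbour v∈D v⟶y u⟶y) (common-neighbour v∈D v⟶y w⟶y)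
                  (⟶-dim v⟶y (IsQuotComp-dim v∈D))
                  (⟶-pairˡ (proj₂ (isO u)) u⟶y) (⟶-pairˡ (proj₂ (isO w)) w⟶y)

      Img-coherent : Dual.Coherent k (Img D) (orient O ∘ O)
      Img-coherent x y w x∈ y∈ _ w⟶x w⟶y =
        σ-pair-agree (proj₂ (isO w))
          (trans (orient-positive (Img-pair x∈ (proj₂ (isO x))) w⟶x)
                 (sym (orient-positive (Img-pair y∈ (proj₂ (isO y))) w⟶y)))
          w⟶x w⟶y

    coherent-transfer : IsCoherentComp k k′ D → Dual.IsCoherentComp k′ k (Img D)
    coherent-transfer (q , ¬sp , O , isO , coh) =
      let (q′ , ¬sp′) = proj₁ (quotient-transfer (q , ¬sp))
      in q′ , ¬sp′ , orient O ∘ O , orient-orientation isO , Img-coherent q isO coh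

  module Duality (I : Incidence) {k k′ : ℤ}
    (⟶-dim  : ∀ {x w} → Incidence._⟶_ I x w → dim x ≡ k → dim w ≡ k′)
    (⟶-dim⁻ : ∀ {w x} → Incidence._⟶_ I x w → dim w ≡ k′ → dim x ≡ k) where
    open Along I
    private
      module Dual = Along (dual I)
      module Forth = Transfer I ⟶-dim ⟶-dim⁻
      module Back = Transfer (dual I) ⟶-dim⁻ ⟶-dim

    cover-inverse : InverseOn (λ D → IsCoverComp k k′ D × ¬ StuckPair D)
                              (λ U → Dual.IsCoverComp k′ k U × ¬ Dual.StuckPair U) Img Dual.Img
    cover-inverse = InverseOn-intro (λ _ → Forth.cover-transfer) (λ _ → Back.cover-transfer)

    quotient-inverse : InverseOn (λ D → IsQuotComp k k′ D × ¬ StuckPair D)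
                                 (λ U → Dual.IsQuotComp k′ k U × ¬ Dual.StuckPair U) Img Dual.Img
    quotient-inverse = InverseOn-intro (λ _ → Forth.quotient-transfer) (λ _ → Back.quotient-transfer)

    coherent-inverse : InverseOn (IsCoherentComp k k′) (Dual.IsCoherentComp k′ k) Img Dual.Img
    coherent-inverse =
      InverseOn-restrict quotient-inverse (λ (q , ¬sp , _) → q , ¬sp) (λ (q , ¬sp , _) → q , ¬sp)
        (λ _ → Forth.coherent-transfer) (λ _ → Back.coherent-transfer)

module _ (Γ : DoubleCover) (strong : StrongGrading Γ) (k : ℤ) where
  open DoubleCover Γ
  open ≡-Reasoning

  coface-dim : ∀ {x w} → x ⊂ w → dim x ≡ k → dim w ≡ k + 1ℤ
  coface-dim {x} {w} x⊂w dx = trans (strong x w x⊂w) (cong (_+ 1ℤ) dx)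

  face-dim : ∀ {x t} → t ⊂ x → dim x ≡ k → dim t ≡ k - 1ℤ
  face-dim {x} {t} t⊂x dx = begin
    dim t              ≡⟨ //-rightDividesʳ 1ℤ (dim t) ⟨
    dim t + 1ℤ - 1ℤ    ≡⟨ cong (_- 1ℤ) (trans (sym (strong t x t⊂x)) dx) ⟩
    k - 1ℤ             ∎

  face-dim⁻ : ∀ {t x} → t ⊂ x → dim t ≡ k - 1ℤ → dim x ≡ k
  face-dim⁻ {t} {x} t⊂x dt = begin
    dim x              ≡⟨ strong t x t⊂x ⟩
    dim t + 1ℤ         ≡⟨ cong (_+ 1ℤ) dt ⟩
    k - 1ℤ + 1ℤ        ≡⟨ //-rightDividesˡ 1ℤ k ⟩
    k                  ∎

  open Duality Γ (faces Γ) face-dim face-dim⁻ public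

  -- The coface side of `Duality` lives in dimensions (k - 1, k), the statement in (k - 1, k - 1 + 1).
  shift : {P : Pred (NodeSet Γ) 0ℓ} (Q : ℤ → Pred (NodeSet Γ) 0ℓ) →
          InverseOn P (Q k) (Below Γ) (Above Γ) → InverseOn P (Q (k - 1ℤ + 1ℤ)) (Below Γ) (Above Γ)
  shift {P} Q = subst (λ m → InverseOn P (Q m) (Below Γ) (Above Γ)) (sym (//-rightDividesˡ 1ℤ k))

lemma1p31 : (Γ : DoubleCover) →
    BijectiveOn (IsCoverComponent Γ) (IsQuotientComponent Γ) (Sat Γ) ×
    (StrongGrading Γ →
      (∀ (k : ℤ) →
        BijectiveOn (IsCoverUpComponent Γ k) (IsQuotientUpComponent Γ k) (Sat Γ) ×
        BijectiveOn (IsCoverDownComponent Γ k) (IsQuotientDownComponent Γ k) (Sat Γ)) ×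
      (∀ (k : ℤ) →
        InverseOn (λ D → IsQuotientDownComponent Γ k D × ¬ IsRootPair Γ D)
                  (λ U → IsQuotientUpComponent Γ (k - 1ℤ) U × ¬ IsLeafPair Γ U)
                  (Below Γ) (Above Γ) ×
        InverseOn (λ D → IsCoverDownComponent Γ k D × ¬ IsRootPair Γ D)
                  (λ U → IsCoverUpComponent Γ (k - 1ℤ) U × ¬ IsLeafPair Γ U)
                  (Below Γ) (Above Γ)) ×
      (∀ (k : ℤ) →
        InverseOn (IsCoherentDown Γ k) (IsCoherentUp Γ (k - 1ℤ)) (Below Γ) (Above Γ)))
lemma1p31 Γ = components-bijective Γ , λ strong →
  (λ k → Graded.Sat-bijective Γ (cofaces Γ) (coface-dim Γ strong k) ,
         Graded.Sat-bijective Γ (faces Γ) (face-dim Γ strong k)) ,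
  (λ k → shift Γ strong k (λ m U → Up.IsQuotComp (k - 1ℤ) m U × ¬ Up.StuckPair U)
                          (quotient-inverse Γ strong k) ,
         shift Γ strong k (λ m U → Up.IsCoverComp (k - 1ℤ) m U × ¬ Up.StuckPair U)
                          (cover-inverse Γ strong k)) ,
  (λ k → shift Γ strong k (Up.IsCoherentComp (k - 1ℤ)) (coherent-inverse Γ strong k))
  where module Up = Along Γ (cofaces Γ)
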